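{- Let $n \geq 1$. The number of triples $(\lambda, i, \mu)$, where $\lambda=(\lambda_1,\dots,\lambda_l)$ is a composition of $n$, $1 \le i \le l$, and $\mu$ is a composition of $\lambda_i$, equals $a_1(2,n-1)$. (That is, if each occurrence of a part $j$ in the compositions of $n$ is replaced in turn by each of the compositions of $j$, the total number of resulting compositions is $a_1(2,n-1)$.)
   Context: A composition of an integer $N\ge0$ is a finite sequence of positive integers summing to $N$. For integers $r \geq 0$ and $N \geq 0$, $a(r,N)$ is the number of ways to tile a $1 \times (N+r)$ grid using $r$ indistinguishable red $1\times 1$ squares and white tiles of arbitrary positive integer lengths of total length $N$ (order matters); $a(r,N)=0$ for $N<0$. Define $a_0(r,N)=a(r,N)$ and, for $s \geq 1$, $a_s(r,N)=\sum_{i=0}^{N} a_{s-1}(r,i)$ (and $0$ for $N<0$). -}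

module Defs where

open import Data.Nat using (ℕ; zero; suc; _+_; _≤_)
open import Data.List using (List; []; _∷_; length; lookup)
open import Data.Nat.ListAction using (sum)
open import Data.List.Relation.Unary.All using (All)
open import Data.Fin using (Fin; toℕ)
open import Data.Product using (Σ; Σ-syntax; _×_)
open import Relation.Binary.PropositionalEquality using (_≡_)

record Composition (N : ℕ) : Set where
  constructor comp
  field
    parts    : List ℕ
    positive : All (1 ≤_) parts
    sums     : sum parts ≡ N

-- Tiles of a 1 × m strip: a red 1×1 square, or a white tile of length k ≥ 1.
data Tile : Set where
  red   : Tile
  white : (k : ℕ) → 1 ≤ k → Tile

redCount : List Tile → ℕ
redCount []              = 0
redCount (red ∷ ts)      = suc (redCount ts)
redCount (white _ _ ∷ ts) = redCount ts

whiteLength : List Tile → ℕ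
whiteLength []               = 0
whiteLength (red ∷ ts)       = whiteLength ts
whiteLength (white k _ ∷ ts) = k + whiteLength ts

-- Tilings counted by a(r,N): ordered sequences of tiles using exactly r red
-- squares and white tiles of total length N (so they tile a 1 × (N+r) strip).
record Tiling (r N : ℕ) : Set where
  constructor tiling
  field
    tiles    : List Tile
    reds     : redCount tiles ≡ r
    whiteLen : whiteLength tiles ≡ N

-- Objects counted by a_1(r,N) = Σ_{i=0}^{N} a(r,i): a pair (i, t), 0 ≤ i ≤ N,
-- t a tiling counted by a(r,i).
A₁ : ℕ → ℕ → Set
A₁ r N = Σ[ i ∈ Fin (suc N) ] Tiling r (toℕ i)

Triple : ℕ → Set
Triple n = Σ[ c ∈ Composition n ]
             Σ[ i ∈ Fin (length (Composition.parts c)) ]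
               Composition (lookup (Composition.parts c) i)

module Submission where

-- Write a positive integer list as the list of predecessors of its
-- parts.  A "frame of size k" consists of three such lists a, m, b and a slack
-- s ≥ 0 with  s + (‖a‖ + ‖m‖ + ‖b‖) = k,  where ‖xs‖ is the sum of the parts.
-- Both sides of the theorem (for n = k + 1) are in bijection with frames:
--
--  * a triple (λ, i, μ) with μ = (s+1, μ₂, …) is sent to the parts of λ before
--    the marked one (a), the tail of μ (m), the parts after the marked one (b),
--    and the slack s;
--  * a tiling with two red squares and white length w ≤ k splits into its three
--    white runs a, m, b (a red square ends each of the first two), and s = k - w.

open import Defs
open import Data.Nat using (ℕ; _≤_; _∸_)
open import Function.Bundles using (_⤖_)

open import Data.Nat using (zero; suc; _+_; z≤n; s≤s; pred)
open import Data.Nat.Properties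
  using (≡-irrelevant; ≤-irrelevant; +-identityʳ; +-assoc; suc-injective; m≤n+m; m∸n+n≡m; m+n∸n≡m)
open import Data.Nat.Tactic.RingSolver using (solve-∀)
open import Data.Nat.ListAction using (sum)
open import Data.Nat.ListAction.Properties using (sum-++)
open import Data.List using (List; []; _∷_; _++_; map; length; lookup)
open import Data.List.Properties using (length-map; map-∘; map-id)
open import Data.List.Relation.Unary.All as All using (All; []; _∷_)
open import Data.List.Relation.Unary.All.Properties using (++⁺; map⁺)
open import Data.Fin using (Fin; zero; suc; toℕ; fromℕ<)
open import Data.Fin.Properties using (toℕ-injective; toℕ-fromℕ<; toℕ≤pred[n])
open import Data.Product using (_×_; _,_; proj₁; proj₂; uncurry)
open import Data.Empty using (⊥-elim)
open import Relation.Binary.PropositionalEquality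
open import Function.Bundles using (_↔_; mk↔ₛ′)
open import Function.Properties.Inverse using (↔⇒⤖)
open import Function.Construct.Composition using (_↔-∘_)

-- Positive integer lists in predecessor form: xs stands for map suc xs.

‖_‖ : List ℕ → ℕ
‖ xs ‖ = sum (map suc xs)

positive-suc : ∀ xs → All (1 ≤_) (map suc xs)
positive-suc xs = map⁺ (All.universal (λ _ → s≤s z≤n) xs)

pred-suc : ∀ xs → map pred (map suc xs) ≡ xs
pred-suc xs = trans (sym (map-∘ xs)) (map-id xs)

suc-pred : ∀ {xs} → All (1 ≤_) xs → map suc (map pred xs) ≡ xs
suc-pred []               = refl
suc-pred (s≤s z≤n ∷ pos) = cong (_ ∷_) (suc-pred pos)

‖pred‖ : ∀ {xs} → All (1 ≤_) xs → ‖ map pred xs ‖ ≡ sum xs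
‖pred‖ pos = cong sum (suc-pred pos)

width : List ℕ → List ℕ → List ℕ → ℕ
width a m b = ‖ a ‖ + (‖ m ‖ + ‖ b ‖)

record Frame (k : ℕ) : Set where
  constructor frame
  field
    left middle right : List ℕ
    slack             : ℕ
    total             : slack + width left middle right ≡ k

frame-≡ : ∀ {k a a′ m m′ b b′ s s′} {e : s + width a m b ≡ k} {e′ : s′ + width a′ m′ b′ ≡ k} →
          a ≡ a′ → m ≡ m′ → b ≡ b′ → s ≡ s′ → frame a m b s e ≡ frame a′ m′ b′ s′ e′
frame-≡ {e = e} {e′} refl refl refl refl = cong (frame _ _ _ _) (≡-irrelevant e e′)

-- Run decomposition: a tile list is its initial white run followed, for each
-- red square, by the white run after it; runs are positive lists in
-- predecessor form, and  runs  and  fromRuns  are mutually inverse.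

Runs : Set
Runs = List ℕ × List (List ℕ)

fromRuns : List ℕ → List (List ℕ) → List Tile
fromRuns []      []       = []
fromRuns []      (r ∷ rs) = red ∷ fromRuns r rs
fromRuns (x ∷ h) rs       = white (suc x) (s≤s z≤n) ∷ fromRuns h rs

startRun : Runs → Runs
startRun (h , rs) = [] , h ∷ rs

extendRun : ℕ → Runs → Runs
extendRun x (h , rs) = x ∷ h , rs

runs : List Tile → Runs
runs []                           = [] , []
runs (red ∷ ts)                   = startRun (runs ts)
runs (white zero () ∷ ts)
runs (white (suc x) (s≤s z≤n) ∷ ts) = extendRun x (runs ts)

fromRuns-runs : ∀ ts → uncurry fromRuns (runs ts) ≡ ts
fromRuns-runs []                             = refl
fromRuns-runs (red ∷ ts)                     = cong (red ∷_) (fromRuns-runs ts)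
fromRuns-runs (white zero () ∷ ts)
fromRuns-runs (white (suc x) (s≤s z≤n) ∷ ts) = cong (_ ∷_) (fromRuns-runs ts)

runs-fromRuns : ∀ h rs → runs (fromRuns h rs) ≡ (h , rs)
runs-fromRuns []      []       = refl
runs-fromRuns []      (r ∷ rs) = cong startRun (runs-fromRuns r rs)
runs-fromRuns (x ∷ h) rs       = cong (extendRun x) (runs-fromRuns h rs)

-- Each run but the first is preceded by exactly one red square.
redCount-fromRuns : ∀ h rs → redCount (fromRuns h rs) ≡ length rs
redCount-fromRuns []      []       = refl
redCount-fromRuns []      (r ∷ rs) = cong suc (redCount-fromRuns r rs)
redCount-fromRuns (x ∷ h) rs       = redCount-fromRuns h rs

whiteLength-fromRuns : ∀ h rs → whiteLength (fromRuns h rs) ≡ ‖ h ‖ + sum (map ‖_‖ rs)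
whiteLength-fromRuns []      []       = refl
whiteLength-fromRuns []      (r ∷ rs) = whiteLength-fromRuns r rs
whiteLength-fromRuns (x ∷ h) rs       =
  trans (cong (suc x +_) (whiteLength-fromRuns h rs)) (sym (+-assoc (suc x) ‖ h ‖ _))

-- whites a, red, whites m, red, whites b.
build : List ℕ → List ℕ → List ℕ → List Tile
build a m b = fromRuns a (m ∷ b ∷ [])

whiteLength-build : ∀ a m b → whiteLength (build a m b) ≡ width a m b
whiteLength-build a m b =
  trans (whiteLength-fromRuns a (m ∷ b ∷ [])) (cong (λ z → ‖ a ‖ + (‖ m ‖ + z)) (+-identityʳ ‖ b ‖))

-- The runs of  build a m b  are a, m, b, so build is injective.
build-injective : ∀ {a a′ m m′ b b′} → build a m b ≡ build a′ m′ b′ → a ≡ a′ × m ≡ m′ × b ≡ b′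
build-injective {a} {a′} {m} {m′} {b} {b′} e
  with trans (sym (runs-fromRuns a (m ∷ b ∷ []))) (trans (cong runs e) (runs-fromRuns a′ (m′ ∷ b′ ∷ [])))
... | refl = refl , refl , refl

record TwoRedView (ts : List Tile) : Set where
  constructor view
  field
    left middle right : List ℕ
    shape             : build left middle right ≡ ts

twoRed : ∀ ts → redCount ts ≡ 2 → TwoRedView ts
twoRed ts reds = viewRuns (runs ts) runCount (fromRuns-runs ts)
  where
  runCount : length (proj₂ (runs ts)) ≡ 2
  runCount = trans (sym (redCount-fromRuns (proj₁ (runs ts)) (proj₂ (runs ts))))
                   (trans (cong redCount (fromRuns-runs ts)) reds)

  viewRuns : ∀ p → length (proj₂ p) ≡ 2 → uncurry fromRuns p ≡ ts → TwoRedView ts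
  viewRuns (a , m ∷ b ∷ [])      _  e = view a m b e
  viewRuns (_ , [])               ()
  viewRuns (_ , _ ∷ [])           ()
  viewRuns (_ , _ ∷ _ ∷ _ ∷ _)    ()

A₁-≡ : ∀ {k} {i i′ : Fin (suc k)} {ts ts′ r r′ w w′} → toℕ i ≡ toℕ i′ → ts ≡ ts′ →
       _≡_ {A = A₁ 2 k} (i , tiling ts r w) (i′ , tiling ts′ r′ w′)
A₁-≡ {i = i} {i′} {r = r} {r′} {w} {w′} ei refl
  with toℕ-injective {i = i} {j = i′} ei
... | refl with ≡-irrelevant r r′ | ≡-irrelevant w w′
...   | refl | refl = refl

lengthIndex : ∀ {k} s w → s + w ≡ k → Fin (suc k)
lengthIndex s w e = fromℕ< (s≤s (subst (w ≤_) e (m≤n+m w s)))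

toℕ-lengthIndex : ∀ {k} s w (e : s + w ≡ k) → toℕ (lengthIndex s w e) ≡ w
toℕ-lengthIndex s w e = toℕ-fromℕ< _

slack-lengthIndex : ∀ {k} s w (e : s + w ≡ k) → k ∸ toℕ (lengthIndex s w e) ≡ s
slack-lengthIndex {k} s w e = begin
  k ∸ toℕ (lengthIndex s w e) ≡⟨ cong (k ∸_) (toℕ-lengthIndex s w e) ⟩
  k ∸ w                       ≡⟨ cong (_∸ w) (sym e) ⟩
  s + w ∸ w                   ≡⟨ m+n∸n≡m s w ⟩
  s                           ∎
  where open ≡-Reasoning

frame↔A₁ : ∀ k → Frame k ↔ A₁ 2 k
frame↔A₁ k = mk↔ₛ′ toA₁ toFrame toA₁-toFrame toFrame-toA₁
  where
  toA₁ : Frame k → A₁ 2 k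
  toA₁ (frame a m b s e) =
    lengthIndex s (width a m b) e ,
    tiling (build a m b) (redCount-fromRuns a (m ∷ b ∷ []))
           (trans (whiteLength-build a m b) (sym (toℕ-lengthIndex s (width a m b) e)))

  widthOfView : ∀ {i ts} (v : TwoRedView ts) → whiteLength ts ≡ toℕ i →
                width (TwoRedView.left v) (TwoRedView.middle v) (TwoRedView.right v) ≡ toℕ i
  widthOfView (view a m b shape) wl =
    trans (sym (whiteLength-build a m b)) (trans (cong whiteLength shape) wl)

  slackTotal : ∀ (i : Fin (suc k)) {w} → w ≡ toℕ i → k ∸ toℕ i + w ≡ k
  slackTotal i w≡i = trans (cong (k ∸ toℕ i +_) w≡i) (m∸n+n≡m (toℕ≤pred[n] i))

  toFrame : A₁ 2 k → Frame k
  toFrame (i , tiling ts reds wl) =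
    frame left middle right (k ∸ toℕ i) (slackTotal i (widthOfView v wl))
    where
    v = twoRed ts reds
    open TwoRedView v

  toA₁-toFrame : ∀ t → toA₁ (toFrame t) ≡ t
  toA₁-toFrame (i , tiling ts reds wl) =
    A₁-≡ (trans (toℕ-lengthIndex (k ∸ toℕ i) _ (slackTotal i (widthOfView v wl))) (widthOfView v wl)) shape
    where
    v = twoRed ts reds
    open TwoRedView v

  toFrame-toA₁ : ∀ f → toFrame (toA₁ f) ≡ f
  toFrame-toA₁ (frame a m b s e)
    with build-injective (TwoRedView.shape (twoRed (build a m b) (redCount-fromRuns a (m ∷ b ∷ []))))
  ... | ea , em , eb = frame-≡ ea em eb (slack-lengthIndex s (width a m b) e)

module _ {A : Set} where

  prefix suffix : (xs : List A) → Fin (length xs) → List A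
  prefix (x ∷ xs) zero    = []
  prefix (x ∷ xs) (suc i) = x ∷ prefix xs i
  suffix (x ∷ xs) zero    = xs
  suffix (x ∷ xs) (suc i) = suffix xs i

  split-at : ∀ xs i → prefix xs i ++ lookup xs i ∷ suffix xs i ≡ xs
  split-at (x ∷ xs) zero    = refl
  split-at (x ∷ xs) (suc i) = cong (x ∷_) (split-at xs i)

  length-prefix : ∀ xs i → length (prefix xs i) ≡ toℕ i
  length-prefix (x ∷ xs) zero    = refl
  length-prefix (x ∷ xs) (suc i) = cong suc (length-prefix xs i)

  All-at : ∀ {P : A → Set} {xs} → All P xs → ∀ i →
           All P (prefix xs i) × P (lookup xs i) × All P (suffix xs i)
  All-at (p ∷ ps) zero    = [] , p , ps
  All-at (p ∷ ps) (suc i) with All-at ps i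
  ... | pre , at , suf = p ∷ pre , at , suf

  point : ∀ xs (y : A) ys → Fin (length (xs ++ y ∷ ys))
  point []       y ys = zero
  point (x ∷ xs) y ys = suc (point xs y ys)

  lookup-point : ∀ xs y ys → lookup (xs ++ y ∷ ys) (point xs y ys) ≡ y
  lookup-point []       y ys = refl
  lookup-point (x ∷ xs) y ys = lookup-point xs y ys

  prefix-point : ∀ xs y ys → prefix (xs ++ y ∷ ys) (point xs y ys) ≡ xs
  prefix-point []       y ys = refl
  prefix-point (x ∷ xs) y ys = cong (x ∷_) (prefix-point xs y ys)

  suffix-point : ∀ xs y ys → suffix (xs ++ y ∷ ys) (point xs y ys) ≡ ys
  suffix-point []       y ys = refl
  suffix-point (x ∷ xs) y ys = suffix-point xs y ys

  toℕ-point : ∀ xs y ys → toℕ (point xs y ys) ≡ length xs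
  toℕ-point xs y ys =
    trans (sym (length-prefix (xs ++ y ∷ ys) (point xs y ys))) (cong length (prefix-point xs y ys))

sum-around : ∀ ps i → sum (prefix ps i) + (lookup ps i + sum (suffix ps i)) ≡ sum ps
sum-around ps i = trans (sym (sum-++ (prefix ps i) _)) (cong sum (split-at ps i))

composition-≡ : ∀ {N} {c c′ : Composition N} → Composition.parts c ≡ Composition.parts c′ → c ≡ c′
composition-≡ {c = comp ps p s} {comp .ps p′ s′} refl
  with All.irrelevant ≤-irrelevant p p′ | ≡-irrelevant s s′
... | refl | refl = refl

triple-≡ : ∀ {n ps ps′ pos pos′ s s′} {i : Fin (length ps)} {i′ : Fin (length ps′)}
           {μ : Composition (lookup ps i)} {μ′ : Composition (lookup ps′ i′)} →
           ps ≡ ps′ → toℕ i ≡ toℕ i′ → Composition.parts μ ≡ Composition.parts μ′ →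
           _≡_ {A = Triple n} (comp ps pos s , i , μ) (comp ps′ pos′ s′ , i′ , μ′)
triple-≡ {ps = ps} {pos = pos} {pos′} {s} {s′} {i} {i′} refl ei eμ
  with All.irrelevant ≤-irrelevant pos pos′ | ≡-irrelevant s s′ | toℕ-injective {i = i} {j = i′} ei
... | refl | refl | refl = cong (λ μ → comp ps pos s , i , μ) (composition-≡ eμ)

marked-nonzero : ∀ {ps} → All (1 ≤_) ps → ∀ i → 0 ≢ lookup ps i
marked-nonzero pos i e with subst (1 ≤_) (sym e) (proj₁ (proj₂ (All-at pos i)))
... | ()

-- The marked part of λ is s + 1 + ‖m‖; this is the arithmetic relating the
-- sum of λ to the total of its frame.
marked-sum : ∀ A s M B → A + (suc (s + M) + B) ≡ suc (s + (A + (M + B)))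
marked-sum = solve-∀

framed : List ℕ → List ℕ → List ℕ → ℕ → List ℕ
framed a m b s = map suc a ++ suc (s + ‖ m ‖) ∷ map suc b

triple↔frame : ∀ k → Triple (suc k) ↔ Frame k
triple↔frame k = mk↔ₛ′ toFrame toTriple toFrame-toTriple toTriple-toFrame
  where
  toFrame : Triple (suc k) → Frame k
  toFrame (comp ps pos sλ , i , comp []          _          sμ) = ⊥-elim (marked-nonzero pos i sμ)
  toFrame (comp ps pos sλ , i , comp (zero ∷ _)  (() ∷ _)   _)
  toFrame (comp ps pos sλ , i , comp (suc s ∷ t) (_ ∷ pos-t) sμ) =
    frame (map pred pre) (map pred t) (map pred suf) s (suc-injective total)
    where
    pre = prefix ps i
    suf = suffix ps i
    total : suc (s + width (map pred pre) (map pred t) (map pred suf)) ≡ suc k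
    total = begin
      suc (s + width (map pred pre) (map pred t) (map pred suf))
        ≡⟨ sym (marked-sum _ s _ _) ⟩
      ‖ map pred pre ‖ + (suc (s + ‖ map pred t ‖) + ‖ map pred suf ‖)
        ≡⟨ cong₂ (λ x y → x + (suc (s + y) + ‖ map pred suf ‖)) (‖pred‖ (proj₁ (All-at pos i))) (‖pred‖ pos-t) ⟩
      sum pre + (suc (s + sum t) + ‖ map pred suf ‖)
        ≡⟨ cong₂ (λ x y → sum pre + (x + y)) sμ (‖pred‖ (proj₂ (proj₂ (All-at pos i)))) ⟩
      sum pre + (lookup ps i + sum suf)
        ≡⟨ sum-around ps i ⟩
      sum ps
        ≡⟨ sλ ⟩
      suc k ∎
      where open ≡-Reasoning

  toTriple : Frame k → Triple (suc k)
  toTriple (frame a m b s e) =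
    comp (framed a m b s) (++⁺ (positive-suc a) (s≤s z≤n ∷ positive-suc b))
         (trans (sum-++ (map suc a) _) (trans (marked-sum (‖ a ‖) s (‖ m ‖) (‖ b ‖)) (cong suc e))) ,
    point (map suc a) _ (map suc b) ,
    comp (suc s ∷ map suc m) (s≤s z≤n ∷ positive-suc m) (sym (lookup-point (map suc a) _ (map suc b)))

  toFrame-toTriple : ∀ f → toFrame (toTriple f) ≡ f
  toFrame-toTriple (frame a m b s e) = frame-≡
    (trans (cong (map pred) (prefix-point (map suc a) _ (map suc b))) (pred-suc a))
    (pred-suc m)
    (trans (cong (map pred) (suffix-point (map suc a) _ (map suc b))) (pred-suc b))
    refl

  toTriple-toFrame : ∀ t → toTriple (toFrame t) ≡ t
  toTriple-toFrame (comp ps pos sλ , i , comp []          _          sμ) = ⊥-elim (marked-nonzero pos i sμ)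
  toTriple-toFrame (comp ps pos sλ , i , comp (zero ∷ _)  (() ∷ _)   _)
  toTriple-toFrame (comp ps pos sλ , i , comp (suc s ∷ t) (_ ∷ pos-t) sμ) =
    triple-≡ parts≡ index≡ (cong (suc s ∷_) (suc-pred pos-t))
    where
    pre = prefix ps i
    suf = suffix ps i
    pos-pre = proj₁ (All-at pos i)
    pos-suf = proj₂ (proj₂ (All-at pos i))

    parts≡ : framed (map pred pre) (map pred t) (map pred suf) s ≡ ps
    parts≡ = begin
      map suc (map pred pre) ++ suc (s + ‖ map pred t ‖) ∷ map suc (map pred suf)
        ≡⟨ cong₂ (λ x y → x ++ suc (s + y) ∷ map suc (map pred suf)) (suc-pred pos-pre) (‖pred‖ pos-t) ⟩
      pre ++ suc (s + sum t) ∷ map suc (map pred suf)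
        ≡⟨ cong₂ (λ x y → pre ++ x ∷ y) sμ (suc-pred pos-suf) ⟩
      pre ++ lookup ps i ∷ suf
        ≡⟨ split-at ps i ⟩
      ps ∎
      where open ≡-Reasoning

    index≡ : toℕ (point (map suc (map pred pre)) _ (map suc (map pred suf))) ≡ toℕ i
    index≡ = begin
      toℕ (point (map suc (map pred pre)) _ (map suc (map pred suf))) ≡⟨ toℕ-point _ _ _ ⟩
      length (map suc (map pred pre))                               ≡⟨ length-map suc (map pred pre) ⟩
      length (map pred pre)                                         ≡⟨ length-map pred pre ⟩
      length pre                                                    ≡⟨ length-prefix ps i ⟩
      toℕ i                                                         ∎
      where open ≡-Reasoning

mainTheorem3 : (n : ℕ) → 1 ≤ n → Triple n ⤖ A₁ 2 (n ∸ 1)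
mainTheorem3 zero    ()
mainTheorem3 (suc k) _ = ↔⇒⤖ (frame↔A₁ k ↔-∘ triple↔frame k)
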